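{- Let $P$ be a finite ranked poset, let $p$ be a minimal element of $P$, and let $P'=\{q\in P:q\not\ge p\}$, a ranked poset with the restricted order and rank function. Then for every antichain $A$ of $P$: (1) if $A\subseteq P'$, then $\operatorname{Rvac}_P(A)=\{p\}\cup\operatorname{Rvac}_{P'}(A)$; (2) if $p\in A$, then $\operatorname{Rvac}_P(A)=\operatorname{Rvac}_{P'}(A\setminus\{p\})$.
   Context: A finite poset $Q$ is ranked if there is $\mathrm{rk}\colon Q\to\mathbb{N}$ with $\mathrm{rk}(q)=0$ for minimal $q$ and $\mathrm{rk}(y)=\mathrm{rk}(x)+1$ when $y$ covers $x$; $\mathrm{rk}(Q)$ is its maximum and $Q_i$ the set of elements of rank $i$. For an antichain $A$ of $Q$ and $q\in Q$, the toggle $\tau_q(A)$ is $A\setminus\{q\}$ if $q\in A$, $A\cup\{q\}$ if $q\notin A$ and $A\cup\{q\}$ is an antichain, and $A$ otherwise; $\boldsymbol{\tau}_i$ is the composite of the commuting toggles $\tau_q$, $q\in Q_i$. With $R=\mathrm{rk}(Q)$ and composition right to left, rowvacuation is $\operatorname{Rvac}_Q=(\boldsymbol{\tau}_R)(\boldsymbol{\tau}_R\boldsymbol{\tau}_{R-1})\cdots(\boldsymbol{\tau}_R\cdots\boldsymbol{\tau}_1)(\boldsymbol{\tau}_R\cdots\boldsymbol{\tau}_0)$, where the toggles are those of $Q$. -}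

module Defs where

open import Data.Nat using (ℕ; zero; suc; _⊔_; _≡ᵇ_)
open import Data.Bool using (Bool; true; false; if_then_else_; not; _∧_; _∨_)
open import Data.Fin using (Fin)
open import Data.Fin.Subset using (Subset; inside; outside; _∈_)
open import Data.Vec using (lookup; tabulate; _[_]≔_)
open import Data.List using (List; foldr)
open import Data.List using () renaming (allFin to allFinL)
open import Data.Product using (_×_)
open import Data.Sum using (_⊎_)
open import Relation.Binary using (Rel; IsDecPartialOrder)
open import Relation.Binary.PropositionalEquality using (_≡_)
open import Relation.Nullary using (does)
open import Level using (0ℓ)

record FinPoset (n : ℕ) : Set₁ where
  field
    _≼_ : Rel (Fin n) 0ℓ
    isDecPartialOrder : IsDecPartialOrder _≡_ _≼_
  open IsDecPartialOrder isDecPartialOrder public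
    using (_≟_) renaming (_≤?_ to _≼?_)

  Covers : Fin n → Fin n → Set
  Covers x y = (x ≼ y) × (¬≡ x y) × (∀ z → x ≼ z → z ≼ y → (z ≡ x) ⊎ (z ≡ y))
    where
      open import Relation.Nullary using (¬_)
      ¬≡ : Fin n → Fin n → Set
      ¬≡ a b = ¬ (a ≡ b)

  Minimal : Fin n → Set
  Minimal q = ∀ x → x ≼ q → x ≡ q

  IsAntichain : Subset n → Set
  IsAntichain A = ∀ x y → x ∈ A → y ∈ A → x ≼ y → x ≡ y

  allᵇ : (Fin n → Bool) → List (Fin n) → Bool
  allᵇ f = foldr (λ x b → f x ∧ b) true

  isAntichainᵇ : Subset n → Bool
  isAntichainᵇ A =
    allᵇ (λ x → allᵇ (λ y →
      not (lookup A x ∧ lookup A y ∧ does (x ≼? y)) ∨ does (x ≟ y)) (allFinL n)) (allFinL n)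

record IsRanked {n : ℕ} (P : FinPoset n) (rk : Fin n → ℕ) : Set where
  open FinPoset P
  field
    rk-min   : ∀ q → Minimal q → rk q ≡ 0
    rk-cover : ∀ x y → Covers x y → rk y ≡ suc (rk x)

module Rowvacuation {n : ℕ} (P : FinPoset n) (rk : Fin n → ℕ) where
  open FinPoset P

  toggle : Fin n → Subset n → Subset n
  toggle q A with lookup A q
  ... | inside  = A [ q ]≔ outside
  ... | outside = if isAntichainᵇ (A [ q ]≔ inside) then A [ q ]≔ inside else A

  -- A subposet Q of P is given by a subset of the carrier, with the
  -- restricted order and rank function.  Its rank rk(Q) = max rank of its
  -- elements (0 if Q is empty).
  rankOf : Subset n → ℕ
  rankOf Q = foldr (λ q m → if lookup Q q then rk q ⊔ m else m) 0 (allFinL n)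

  τ : Subset n → ℕ → Subset n → Subset n
  τ Q i A = foldr (λ q B → if lookup Q q ∧ (rk q ≡ᵇ i) then toggle q B else B) A (allFinL n)

  sweep : Subset n → ℕ → ℕ → Subset n → Subset n
  sweep Q j zero    A = A
  sweep Q j (suc c) A = sweep Q (suc j) c (τ Q j A)

  -- 𝛕_R ⋯ 𝛕_j  (𝛕_j applied first)
  segment : Subset n → ℕ → Subset n → Subset n
  segment Q j = sweep Q j (suc (rankOf Q) Data.Nat.∸ j)

  loop : Subset n → ℕ → ℕ → Subset n → Subset n
  loop Q j zero    A = A
  loop Q j (suc c) A = loop Q (suc j) c (segment Q j A)

  -- Rvac_Q = (𝛕_R)(𝛕_R 𝛕_{R-1}) ⋯ (𝛕_R ⋯ 𝛕_0), R = rk(Q)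
  Rvac : Subset n → Subset n → Subset n
  Rvac Q = loop Q 0 (suc (rankOf Q))

  P′ : Fin n → Subset n
  P′ p = tabulate (λ q → not (does (p ≼? q)))

-- Write ↑p = {q : p ≼ q}, so that P′ = P ∖ ↑p.  Run the toggles of Rvac_P on A and
-- those of Rvac_P′ on A′ (A′ = A, resp. A ∖ {p}) side by side: as long as the two
-- antichains agree off ↑p and the P-antichain has no element of ↑p above the element q
-- being toggled, τ_q acts identically on both sides.  It then suffices to follow the
-- ↑p-part of the P-antichain.
-- (1) 𝛕_0 inserts p; afterwards p blocks every other element of ↑p, so the ↑p-part
--     stays {p}.
-- (2) The ↑p-part starts as {p} at rank 0.  The j-th segment 𝛕_R ⋯ 𝛕_j removes the
--     ↑p-part of rank j, 𝛕_{j+1} inserts every element of ↑p of rank j + 1 that is not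
--     blocked from below by P′, and the higher toggles leave ↑p alone, since every
--     element of ↑p of higher rank lies above one of rank j + 1 that is either present
--     or blocked.  The last segment 𝛕_R empties the ↑p-part.
module Submission where

open import Defs
open import Data.Bool using (Bool; true; false; if_then_else_; not; _∧_; _∨_)
open import Data.Bool.Properties using (¬-not; T-≡; ∧-zeroʳ) renaming (_≟_ to _≟ᵇ_)
open import Data.Empty using (⊥-elim)
open import Data.Fin using (Fin; zero; suc)
open import Data.Fin.Induction using (po-wellFounded; po-noetherian)
open import Data.Fin.Properties using (any?)
open import Data.Fin.Subset using (Subset; ⊤; ⁅_⁆; _∪_; _∈_; _⊆_; _-_)
open import Data.Fin.Subset.Properties using (x∈⁅x⁆; x≢y⇒x∉⁅y⁆; p─⊥≡p; p─q⊆p)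
open import Data.List using (List; []; _∷_; foldr) renaming (allFin to allFinL)
open import Data.List.Membership.Propositional using () renaming (_∈_ to _∈L_)
open import Data.List.Membership.Propositional.Properties using (∈-allFin)
open import Data.List.Relation.Unary.All.Properties using (All¬⇒¬Any)
open import Data.List.Relation.Unary.Any using (here; there)
open import Data.List.Relation.Unary.AllPairs using (_∷_)
open import Data.List.Relation.Unary.Unique.Propositional using (Unique)
open import Data.List.Relation.Unary.Unique.Propositional.Properties using (allFin⁺)
open import Data.Nat using (ℕ; zero; suc; _≤_; _<_; z≤n; s≤s; _≡ᵇ_; _⊔_; _∸_; _+_)
open import Data.Nat.Properties
  using ( ≤-refl; ≤-trans; ≤-reflexive; ≤-antisym; ≤-pred; ≤∧≢⇒<; <⇒≤; <⇒≢; <-irrefl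
        ; <-trans; ≤-<-trans; <-≤-trans; ≤⇒≯; n≤1+n; m≤m⊔n; m≤n⊔m; ⊔-lub; m≤n+m∸n; m+n∸m≡n
        ; +-suc; +-identityʳ; ≡ᵇ⇒≡; ≡⇒≡ᵇ )
  renaming (_≟_ to _≟ℕ_)
open import Data.Product using (∃-syntax; _×_; _,_; proj₁; proj₂)
open import Data.Sum using (_⊎_; inj₁; inj₂)
open import Data.Vec using (Vec; _∷_; lookup; _[_]≔_)
open import Data.Vec.Properties
  using ( lookup∘update; lookup∘update′; lookup-replicate; lookup-zipWith; lookup∘tabulate
        ; tabulate∘lookup; tabulate-cong; []=⇒lookup; lookup⇒[]= )
open import Function using (_∘_; flip)
open import Function.Bundles using (Equivalence)
open import Induction.WellFounded using (Acc; acc; WellFounded)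
open import Relation.Binary using (IsDecPartialOrder)
open import Relation.Binary.PropositionalEquality
  using (_≡_; _≢_; refl; sym; trans; cong; subst)
open import Relation.Nullary using (¬_; Dec; yes; no; does)
open import Relation.Nullary.Decidable using (_×-dec_; _⊎-dec_; ¬?; dec-true; dec-false)

false≢true : false ≢ true
false≢true ()

≡ᵇ-refl : ∀ m → (m ≡ᵇ m) ≡ true
≡ᵇ-refl m = Equivalence.to T-≡ (≡⇒≡ᵇ m m refl)

≢⇒≡ᵇ-false : ∀ {m k} → m ≢ k → (m ≡ᵇ k) ≡ false
≢⇒≡ᵇ-false {m} {k} m≢k = ¬-not (m≢k ∘ ≡ᵇ⇒≡ m k ∘ Equivalence.from T-≡)

lookup-ext : ∀ {m} (xs ys : Vec Bool m) → (∀ i → lookup xs i ≡ lookup ys i) → xs ≡ ys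
lookup-ext xs ys eq =
  trans (sym (tabulate∘lookup xs)) (trans (tabulate-cong eq) (tabulate∘lookup ys))

lookup-⁅⁆-≢ : ∀ {m} {q x : Fin m} → x ≢ q → lookup ⁅ q ⁆ x ≡ false
lookup-⁅⁆-≢ {q = q} {x} x≢q = ¬-not (x≢y⇒x∉⁅y⁆ x≢q ∘ lookup⇒[]= x ⁅ q ⁆)

lookup-minus-self : ∀ {m} (A : Subset m) q → lookup (A - q) q ≡ false
lookup-minus-self (a ∷ A) zero    = refl
lookup-minus-self (a ∷ A) (suc q) = lookup-minus-self A q

lookup-minus-≢ : ∀ {m} (A : Subset m) q x → x ≢ q → lookup (A - q) x ≡ lookup A x
lookup-minus-≢ (a ∷ A) zero    zero    x≢q = ⊥-elim (x≢q refl)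
lookup-minus-≢ (a ∷ A) zero    (suc x) _   = cong (λ B → lookup B x) (p─⊥≡p A)
lookup-minus-≢ (a ∷ A) (suc q) zero    _   = refl
lookup-minus-≢ (a ∷ A) (suc q) (suc x) x≢q = lookup-minus-≢ A q x (x≢q ∘ cong suc)

module RankedPosetProperties {n : ℕ} (P : FinPoset n) (rk : Fin n → ℕ)
                             (isRanked : IsRanked P rk) where
  open FinPoset P
  open IsRanked isRanked
  private module ≼ = IsDecPartialOrder isDecPartialOrder

  _≺_ : Fin n → Fin n → Set
  x ≺ y = x ≼ y × x ≢ y

  covers⇒≺ : ∀ {x y} → Covers x y → x ≺ y
  covers⇒≺ (x≼y , x≢y , _) = x≼y , x≢y

  private
    ≺-wellFounded : WellFounded _≺_
    ≺-wellFounded = po-wellFounded ≼.isPartialOrder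

    ≻-wellFounded : WellFounded (flip _≺_)
    ≻-wellFounded = po-noetherian ≼.isPartialOrder

    between? : ∀ a u → Dec (∃[ z ] a ≺ z × z ≺ u)
    between? a u =
      any? (λ z → ((a ≼? z) ×-dec ¬? (a ≟ z)) ×-dec ((z ≼? u) ×-dec ¬? (z ≟ u)))

    cover-above′ : ∀ u a → Acc (flip _≺_) a → a ≺ u → ∃[ w ] a ≼ w × Covers w u
    cover-above′ u a (acc rec) a≺u with between? a u
    ... | yes (z , a≺z , z≺u) with cover-above′ u z (rec a≺z) z≺u
    ...   | w , z≼w , w⋖u = w , ≼.trans (proj₁ a≺z) z≼w , w⋖u
    cover-above′ u a (acc rec) (a≼u , a≢u) | no nothing-between =
      a , ≼.refl , a≼u , a≢u , covering
      where
      covering : ∀ z → a ≼ z → z ≼ u → (z ≡ a) ⊎ (z ≡ u)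
      covering z a≼z z≼u with z ≟ a | z ≟ u
      ... | yes z≡a | _       = inj₁ z≡a
      ... | no _    | yes z≡u = inj₂ z≡u
      ... | no z≢a  | no z≢u  =
        ⊥-elim (nothing-between (z , (a≼z , z≢a ∘ sym) , z≼u , z≢u))

  cover-above : ∀ {a u} → a ≺ u → ∃[ w ] a ≼ w × Covers w u
  cover-above {a} {u} = cover-above′ u a (≻-wellFounded a)

  private
    rk-strictMono′ : ∀ y → Acc _≺_ y → ∀ {x} → x ≺ y → rk x < rk y
    rk-strictMono′ y (acc rec) {x} x≺y with cover-above x≺y
    ... | w , x≼w , w⋖y with x ≟ w
    ...   | yes refl = ≤-reflexive (sym (rk-cover x y w⋖y))
    ...   | no x≢w   = <-trans (rk-strictMono′ w (rec (covers⇒≺ w⋖y)) (x≼w , x≢w))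
                               (≤-reflexive (sym (rk-cover w y w⋖y)))

  rk-strictMono : ∀ {x y} → x ≺ y → rk x < rk y
  rk-strictMono {x} {y} = rk-strictMono′ y (≺-wellFounded y)

  ≼∧rk≡⇒≡ : ∀ {x y} → x ≼ y → rk x ≡ rk y → x ≡ y
  ≼∧rk≡⇒≡ {x} {y} x≼y rkx≡rky with x ≟ y
  ... | yes x≡y = x≡y
  ... | no x≢y  = ⊥-elim (<-irrefl rkx≡rky (rk-strictMono (x≼y , x≢y)))

  ≺⇒rk≢ : ∀ {y q i} → y ≺ q → rk q ≡ i → rk y ≢ i
  ≺⇒rk≢ y≺q refl = <⇒≢ (rk-strictMono y≺q)

  private
    intermediate-rank′ : ∀ u → Acc _≺_ u → ∀ a k → a ≼ u → rk a ≤ k → k ≤ rk u →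
                         ∃[ z ] a ≼ z × z ≼ u × rk z ≡ k
    intermediate-rank′ u (acc rec) a k a≼u rka≤k k≤rku with k ≟ℕ rk u
    ... | yes k≡rku = u , a≼u , ≼.refl , sym k≡rku
    ... | no k≢rku with a ≟ u
    ...   | yes refl = ⊥-elim (k≢rku (≤-antisym k≤rku rka≤k))
    ...   | no a≢u with cover-above (a≼u , a≢u)
    ...     | w , a≼w , w⋖u
            with intermediate-rank′ w (rec (covers⇒≺ w⋖u)) a k a≼w rka≤k k≤rkw
      where
      k≤rkw : k ≤ rk w
      k≤rkw = ≤-pred (subst (suc k ≤_) (rk-cover w u w⋖u) (≤∧≢⇒< k≤rku k≢rku))
    ...       | z , a≼z , z≼w , rkz≡k = z , a≼z , ≼.trans z≼w (proj₁ w⋖u) , rkz≡k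

  intermediate-rank : ∀ {a u} k → a ≼ u → rk a ≤ k → k ≤ rk u →
                      ∃[ z ] a ≼ z × z ≼ u × rk z ≡ k
  intermediate-rank {a} {u} k = intermediate-rank′ u (≺-wellFounded u) a k

module AntichainTest {n : ℕ} (P : FinPoset n) where
  open FinPoset P

  Antichain : Subset n → Set
  Antichain B = ∀ x y → lookup B x ≡ true → lookup B y ≡ true → x ≼ y → x ≡ y

  Comparable : Fin n → Fin n → Set
  Comparable x y = (x ≼ y) ⊎ (y ≼ x)

  Antichain-anti-mono : ∀ {A B} → (∀ x → lookup B x ≡ true → lookup A x ≡ true) →
                        Antichain A → Antichain B
  Antichain-anti-mono B⊆A ac x y x∈B y∈B = ac x y (B⊆A x x∈B) (B⊆A y y∈B)

  private
    allᵇ-sound : ∀ f L → allᵇ f L ≡ true → ∀ x → x ∈L L → f x ≡ true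
    allᵇ-sound f (y ∷ L) all-true x x∈L with f y in fy
    allᵇ-sound f (y ∷ L) all-true x (here refl) | true = fy
    allᵇ-sound f (y ∷ L) all-true x (there x∈L) | true = allᵇ-sound f L all-true x x∈L

    allᵇ-complete : ∀ f L → (∀ x → f x ≡ true) → allᵇ f L ≡ true
    allᵇ-complete f []      _     = refl
    allᵇ-complete f (y ∷ L) f-true rewrite f-true y = allᵇ-complete f L f-true

    pairOKᵇ : Subset n → Fin n → Fin n → Bool
    pairOKᵇ B x y = not (lookup B x ∧ lookup B y ∧ does (x ≼? y)) ∨ does (x ≟ y)

  isAntichainᵇ-sound : ∀ B → isAntichainᵇ B ≡ true → Antichain B
  isAntichainᵇ-sound B test x y x∈B y∈B x≼y
    with allᵇ-sound (pairOKᵇ B x) (allFinL n)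
           (allᵇ-sound (λ x → allᵇ (pairOKᵇ B x) (allFinL n)) (allFinL n) test x (∈-allFin x))
           y (∈-allFin y)
  ... | pair-ok rewrite x∈B | y∈B with x ≼? y | x ≟ y
  ...   | _       | yes x≡y = x≡y
  ...   | no x⋠y  | _       = ⊥-elim (x⋠y x≼y)
  isAntichainᵇ-sound B test x y x∈B y∈B x≼y | () | yes _ | no _

  isAntichainᵇ-complete : ∀ B → Antichain B → isAntichainᵇ B ≡ true
  isAntichainᵇ-complete B ac =
    allᵇ-complete (λ x → allᵇ (pairOKᵇ B x) (allFinL n)) (allFinL n)
      (λ x → allᵇ-complete (pairOKᵇ B x) (allFinL n) (pair-ok x))
    where
    pair-ok : ∀ x y → pairOKᵇ B x y ≡ true
    pair-ok x y with lookup B x in x∈B | lookup B y in y∈B | x ≼? y | x ≟ y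
    ... | false | _     | _       | _      = refl
    ... | true  | false | _       | _      = refl
    ... | true  | true  | no _    | _      = refl
    ... | true  | true  | yes _   | yes _  = refl
    ... | true  | true  | yes x≼y | no x≢y = ⊥-elim (x≢y (ac x y x∈B y∈B x≼y))

  insert-comparable-fails : ∀ B q y → lookup B y ≡ true → y ≢ q → Comparable y q →
                            isAntichainᵇ (B [ q ]≔ true) ≡ false
  insert-comparable-fails B q y y∈B y≢q y∼q = ¬-not (fails y∼q)
    where
    y∈B′ : lookup (B [ q ]≔ true) y ≡ true
    y∈B′ = trans (lookup∘update′ y≢q B true) y∈B
    fails : Comparable y q → isAntichainᵇ (B [ q ]≔ true) ≢ true
    fails (inj₁ y≼q) test =
      y≢q (isAntichainᵇ-sound (B [ q ]≔ true) test y q y∈B′ (lookup∘update q B true) y≼q)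
    fails (inj₂ q≼y) test =
      y≢q (sym (isAntichainᵇ-sound (B [ q ]≔ true) test q y (lookup∘update q B true) y∈B′ q≼y))

  insert-fails⇒comparable : ∀ B q → Antichain B → isAntichainᵇ (B [ q ]≔ true) ≡ false →
                            ∃[ y ] lookup B y ≡ true × y ≢ q × Comparable y q
  insert-fails⇒comparable B q ac fails
    with any? (λ y → (lookup B y ≟ᵇ true) ×-dec ¬? (y ≟ q) ×-dec ((y ≼? q) ⊎-dec (q ≼? y)))
  ... | yes witness = witness
  ... | no none     =
    ⊥-elim (false≢true (trans (sym fails) (isAntichainᵇ-complete (B [ q ]≔ true) ac′)))
    where
    below : ∀ x → lookup (B [ q ]≔ true) x ≡ true → x ≢ q → lookup B x ≡ true
    below x x∈B′ x≢q = trans (sym (lookup∘update′ x≢q B true)) x∈B′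
    ac′ : Antichain (B [ q ]≔ true)
    ac′ x y x∈B′ y∈B′ x≼y with x ≟ q | y ≟ q
    ... | yes refl | yes refl = refl
    ... | no x≢q   | no y≢q   = ac x y (below x x∈B′ x≢q) (below y y∈B′ y≢q) x≼y
    ... | yes refl | no y≢q   = ⊥-elim (none (y , below y y∈B′ y≢q , y≢q , inj₂ x≼y))
    ... | no x≢q   | yes refl = ⊥-elim (none (x , below x x∈B′ x≢q , x≢q , inj₁ x≼y))

module ToggleProperties {n : ℕ} (P : FinPoset n) (rk : Fin n → ℕ) where
  open FinPoset P
  open Rowvacuation P rk
  open AntichainTest P

  toggle-≢ : ∀ q S x → x ≢ q → lookup (toggle q S) x ≡ lookup S x
  toggle-≢ q S x x≢q with lookup S q
  ... | true = lookup∘update′ x≢q S false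
  ... | false with isAntichainᵇ (S [ q ]≔ true)
  ...   | true  = lookup∘update′ x≢q S true
  ...   | false = refl

  toggle-remove : ∀ q S → lookup S q ≡ true → toggle q S ≡ S [ q ]≔ false
  toggle-remove q S q∈S rewrite q∈S = refl

  toggle-insert : ∀ q S → lookup S q ≡ false → isAntichainᵇ (S [ q ]≔ true) ≡ true →
                  toggle q S ≡ S [ q ]≔ true
  toggle-insert q S q∉S ok rewrite q∉S | ok = refl

  toggle-blocked : ∀ q S → lookup S q ≡ false → isAntichainᵇ (S [ q ]≔ true) ≡ false →
                   toggle q S ≡ S
  toggle-blocked q S q∉S fails rewrite q∉S | fails = refl

  toggle-self-inside : ∀ q S → lookup S q ≡ true → lookup (toggle q S) q ≡ false
  toggle-self-inside q S q∈S rewrite toggle-remove q S q∈S = lookup∘update q S false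

  toggle-self-outside : ∀ q S → lookup S q ≡ false →
                        lookup (toggle q S) q ≡ isAntichainᵇ (S [ q ]≔ true)
  toggle-self-outside q S q∉S with isAntichainᵇ (S [ q ]≔ true) in test
  ... | true  rewrite toggle-insert q S q∉S test = lookup∘update q S true
  ... | false rewrite toggle-blocked q S q∉S test = q∉S

  toggle-preserves-Antichain : ∀ q S → Antichain S → Antichain (toggle q S)
  toggle-preserves-Antichain q S ac with lookup S q in q∈S
  ... | true = Antichain-anti-mono {S} {S [ q ]≔ false} removed ac
    where
    removed : ∀ x → lookup (S [ q ]≔ false) x ≡ true → lookup S x ≡ true
    removed x x∈S′ with x ≟ q
    ... | yes refl = ⊥-elim (false≢true (trans (sym (lookup∘update q S false)) x∈S′))
    ... | no x≢q   = trans (sym (lookup∘update′ x≢q S false)) x∈S′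
  ... | false with isAntichainᵇ (S [ q ]≔ true) in test
  ...   | true  = isAntichainᵇ-sound (S [ q ]≔ true) test
  ...   | false = ac

  τ-step : Subset n → ℕ → Fin n → Subset n → Subset n
  τ-step Q i q B = if lookup Q q ∧ (rk q ≡ᵇ i) then toggle q B else B

  τ-over : Subset n → ℕ → List (Fin n) → Subset n → Subset n
  τ-over Q i L A = foldr (τ-step Q i) A L

  τ-step-toggle : ∀ {Q i q} B → lookup Q q ≡ true → rk q ≡ i → τ-step Q i q B ≡ toggle q B
  τ-step-toggle {q = q} B q∈Q refl rewrite q∈Q | ≡ᵇ-refl (rk q) = refl

  τ-step-outside : ∀ {Q i q} B → lookup Q q ≡ false → τ-step Q i q B ≡ B
  τ-step-outside B q∉Q rewrite q∉Q = refl

  τ-step-otherRank : ∀ {Q i q} B → rk q ≢ i → τ-step Q i q B ≡ B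
  τ-step-otherRank {Q} {q = q} B rkq≢i
    rewrite ≢⇒≡ᵇ-false rkq≢i | ∧-zeroʳ (lookup Q q) = refl

module RankTruncation {n : ℕ} (P : FinPoset n) (rk : Fin n → ℕ) where
  open Rowvacuation P rk
  open ToggleProperties P rk

  private
    rankOver : Subset n → List (Fin n) → ℕ
    rankOver Q L = foldr (λ q m → if lookup Q q then rk q ⊔ m else m) 0 L

    rk≤rankOver : ∀ Q L q → q ∈L L → lookup Q q ≡ true → rk q ≤ rankOver Q L
    rk≤rankOver Q (y ∷ L) q (here refl) q∈Q rewrite q∈Q = m≤m⊔n (rk q) _
    rk≤rankOver Q (y ∷ L) q (there q∈L) q∈Q with lookup Q y
    ... | true  = ≤-trans (rk≤rankOver Q L q q∈L q∈Q) (m≤n⊔m (rk y) _)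
    ... | false = rk≤rankOver Q L q q∈L q∈Q

    rankOver-lub : ∀ Q L M → (∀ q → lookup Q q ≡ true → rk q ≤ M) → rankOver Q L ≤ M
    rankOver-lub Q []      M bound = z≤n
    rankOver-lub Q (y ∷ L) M bound with lookup Q y in y∈Q
    ... | true  = ⊔-lub (bound y y∈Q) (rankOver-lub Q L M bound)
    ... | false = rankOver-lub Q L M bound

  rk≤rankOf : ∀ Q q → lookup Q q ≡ true → rk q ≤ rankOf Q
  rk≤rankOf Q q = rk≤rankOver Q (allFinL n) q (∈-allFin q)

  rankOf-lub : ∀ Q M → (∀ q → lookup Q q ≡ true → rk q ≤ M) → rankOf Q ≤ M
  rankOf-lub Q = rankOver-lub Q (allFinL n)

  τ-aboveRank : ∀ Q i A → rankOf Q < i → τ Q i A ≡ A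
  τ-aboveRank Q i A rankQ<i = go (allFinL n)
    where
    go : ∀ L → τ-over Q i L A ≡ A
    go []      = refl
    go (q ∷ L) with lookup Q q in q∈Q
    ... | false = go L
    ... | true rewrite ≢⇒≡ᵇ-false {rk q} {i} (<⇒≢ (≤-<-trans (rk≤rankOf Q q q∈Q) rankQ<i)) = go L

  sweep-aboveRank : ∀ Q j c A → rankOf Q < j → sweep Q j c A ≡ A
  sweep-aboveRank Q j zero    A _        = refl
  sweep-aboveRank Q j (suc c) A rankQ<j rewrite τ-aboveRank Q j A rankQ<j =
    sweep-aboveRank Q (suc j) c A (≤-trans rankQ<j (n≤1+n j))

  sweep-length-irrelevant : ∀ Q j c c′ A → suc (rankOf Q) ≤ j + c → suc (rankOf Q) ≤ j + c′ →
                            sweep Q j c A ≡ sweep Q j c′ A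
  sweep-length-irrelevant Q j zero    zero     A _ _ = refl
  sweep-length-irrelevant Q j zero    (suc c′) A h _ =
    sym (sweep-aboveRank Q j (suc c′) A (subst (suc (rankOf Q) ≤_) (+-identityʳ j) h))
  sweep-length-irrelevant Q j (suc c) zero     A _ h =
    sweep-aboveRank Q j (suc c) A (subst (suc (rankOf Q) ≤_) (+-identityʳ j) h)
  sweep-length-irrelevant Q j (suc c) (suc c′) A h h′ =
    sweep-length-irrelevant Q (suc j) c c′ (τ Q j A)
      (subst (suc (rankOf Q) ≤_) (+-suc j c) h) (subst (suc (rankOf Q) ≤_) (+-suc j c′) h′)

  -- `loop` with an arbitrary rank bound R ≥ rankOf Q, so that Rvac_P and Rvac_P′
  -- (whose rank may be smaller) can be run through the same segments.
  loopUpTo : Subset n → ℕ → ℕ → ℕ → Subset n → Subset n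
  loopUpTo Q R j zero    A = A
  loopUpTo Q R j (suc c) A = loopUpTo Q R (suc j) c (sweep Q j (suc R ∸ j) A)

  private
    loop≡loopUpTo : ∀ Q j c A → loop Q j c A ≡ loopUpTo Q (rankOf Q) j c A
    loop≡loopUpTo Q j zero    A = refl
    loop≡loopUpTo Q j (suc c) A = loop≡loopUpTo Q (suc j) c (segment Q j A)

    loopUpTo-aboveRank : ∀ Q R j c A → rankOf Q < j → loopUpTo Q R j c A ≡ A
    loopUpTo-aboveRank Q R j zero    A _ = refl
    loopUpTo-aboveRank Q R j (suc c) A rankQ<j
      rewrite sweep-aboveRank Q j (suc R ∸ j) A rankQ<j =
      loopUpTo-aboveRank Q R (suc j) c A (≤-trans rankQ<j (n≤1+n j))

    loopUpTo-bound-irrelevant :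
      ∀ Q R j c c′ A → rankOf Q ≤ R → suc (rankOf Q) ≤ j + c → suc (rankOf Q) ≤ j + c′ →
      loopUpTo Q R j c A ≡ loopUpTo Q (rankOf Q) j c′ A
    loopUpTo-bound-irrelevant Q R j zero    zero     A _ _ _ = refl
    loopUpTo-bound-irrelevant Q R j zero    (suc c′) A _ h _ =
      sym (loopUpTo-aboveRank Q (rankOf Q) j (suc c′) A (subst (suc (rankOf Q) ≤_) (+-identityʳ j) h))
    loopUpTo-bound-irrelevant Q R j (suc c) zero     A _ _ h =
      loopUpTo-aboveRank Q R j (suc c) A (subst (suc (rankOf Q) ≤_) (+-identityʳ j) h)
    loopUpTo-bound-irrelevant Q R j (suc c) (suc c′) A rankQ≤R h h′
      rewrite sweep-length-irrelevant Q j (suc R ∸ j) (suc (rankOf Q) ∸ j) A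
                (≤-trans (s≤s rankQ≤R) (m≤n+m∸n (suc R) j)) (m≤n+m∸n (suc (rankOf Q)) j) =
      loopUpTo-bound-irrelevant Q R (suc j) c c′ _ rankQ≤R
        (subst (suc (rankOf Q) ≤_) (+-suc j c) h) (subst (suc (rankOf Q) ≤_) (+-suc j c′) h′)

  Rvac≡loopUpTo : ∀ Q R A → rankOf Q ≤ R → Rvac Q A ≡ loopUpTo Q R 0 (suc R) A
  Rvac≡loopUpTo Q R A rankQ≤R =
    trans (loop≡loopUpTo Q 0 (suc (rankOf Q)) A)
          (sym (loopUpTo-bound-irrelevant Q R 0 (suc R) (suc (rankOf Q)) A
                  rankQ≤R (s≤s rankQ≤R) ≤-refl))

module Coupling {n : ℕ} (P : FinPoset n) (rk : Fin n → ℕ) (p : Fin n) where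
  open FinPoset P
  open Rowvacuation P rk
  open AntichainTest P
  open ToggleProperties P rk
  private module ≼ = IsDecPartialOrder isDecPartialOrder

  P′-upset : ∀ {q} → p ≼ q → lookup (P′ p) q ≡ false
  P′-upset {q} p≼q = trans (lookup∘tabulate _ q) (cong not (dec-true (p ≼? q) p≼q))

  P′-off-upset : ∀ {q} → ¬ (p ≼ q) → lookup (P′ p) q ≡ true
  P′-off-upset {q} p⋠q = trans (lookup∘tabulate _ q) (cong not (dec-false (p ≼? q) p⋠q))

  AgreeOffUpset : Subset n → Subset n → Set
  AgreeOffUpset S S′ = ∀ x → ¬ (p ≼ x) → lookup S x ≡ lookup S′ x

  AvoidsUpset : Subset n → Set
  AvoidsUpset S = ∀ x → p ≼ x → lookup S x ≡ false

  record Coupled (S S′ : Subset n) : Set where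
    field
      antichain  : Antichain S
      antichain′ : Antichain S′
      agree      : AgreeOffUpset S S′
      avoids     : AvoidsUpset S′
  open Coupled public

  avoids-absurd : ∀ {u} S → AvoidsUpset S → p ≼ u → lookup S u ≢ true
  avoids-absurd S avoidsS p≼u u∈S = false≢true (trans (sym (avoidsS _ p≼u)) u∈S)

  NoUpsetAbove : Fin n → Subset n → Set
  NoUpsetAbove q B = ∀ u → p ≼ u → lookup B u ≡ true → ¬ (q ≼ u)

  private
    insert-agrees : ∀ {B B′} q → Coupled B B′ → NoUpsetAbove q B → ¬ (p ≼ q) →
                    lookup B q ≡ false →
                    isAntichainᵇ (B [ q ]≔ true) ≡ isAntichainᵇ (B′ [ q ]≔ true)
    insert-agrees {B} {B′} q c noAbove p⋠q q∉B with isAntichainᵇ (B [ q ]≔ true) in test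
    ... | true = sym (isAntichainᵇ-complete (B′ [ q ]≔ true)
                   (Antichain-anti-mono {B [ q ]≔ true} {B′ [ q ]≔ true} shrink
                     (isAntichainᵇ-sound (B [ q ]≔ true) test)))
      where
      shrink : ∀ x → lookup (B′ [ q ]≔ true) x ≡ true → lookup (B [ q ]≔ true) x ≡ true
      shrink x x∈B′ with x ≟ q
      ... | yes refl = lookup∘update q B true
      ... | no x≢q with p ≼? x
      ...   | yes p≼x =
        ⊥-elim (avoids-absurd B′ (avoids c) p≼x (trans (sym (lookup∘update′ x≢q B′ true)) x∈B′))
      ...   | no p⋠x  = trans (lookup∘update′ x≢q B true)
                (trans (agree c x p⋠x) (trans (sym (lookup∘update′ x≢q B′ true)) x∈B′))
    ... | false with insert-fails⇒comparable B q (antichain c) test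
    ...   | y , y∈B , y≢q , y∼q with p ≼? y | y∼q
    ...     | yes p≼y | inj₁ y≼q = ⊥-elim (p⋠q (≼.trans p≼y y≼q))
    ...     | yes p≼y | inj₂ q≼y = ⊥-elim (noAbove y p≼y y∈B q≼y)
    ...     | no p⋠y  | _        =
      sym (insert-comparable-fails B′ q y (trans (sym (agree c y p⋠y)) y∈B) y≢q y∼q)

  toggle-off-upset : ∀ {B B′} q → Coupled B B′ → NoUpsetAbove q B → ¬ (p ≼ q) →
                     Coupled (toggle q B) (toggle q B′)
  toggle-off-upset {B} {B′} q c noAbove p⋠q = record
    { antichain  = toggle-preserves-Antichain q B (antichain c)
    ; antichain′ = toggle-preserves-Antichain q B′ (antichain′ c)
    ; agree      = agree′
    ; avoids     = avoids′
    }
    where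
    at-q : ∀ b → lookup B q ≡ b → lookup (toggle q B) q ≡ lookup (toggle q B′) q
    at-q true  q∈B = trans (toggle-self-inside q B q∈B)
                       (sym (toggle-self-inside q B′ (trans (sym (agree c q p⋠q)) q∈B)))
    at-q false q∉B = trans (toggle-self-outside q B q∉B)
                       (trans (insert-agrees q c noAbove p⋠q q∉B)
                         (sym (toggle-self-outside q B′ (trans (sym (agree c q p⋠q)) q∉B))))
    agree′ : AgreeOffUpset (toggle q B) (toggle q B′)
    agree′ x p⋠x with x ≟ q
    ... | yes refl = at-q (lookup B x) refl
    ... | no x≢q   = trans (toggle-≢ q B x x≢q) (trans (agree c x p⋠x) (sym (toggle-≢ q B′ x x≢q)))
    avoids′ : AvoidsUpset (toggle q B′)
    avoids′ x p≼x with x ≟ q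
    ... | yes refl = ⊥-elim (p⋠q p≼x)
    ... | no x≢q   = trans (toggle-≢ q B′ x x≢q) (avoids c x p≼x)

  toggle-upset : ∀ {B B′} q → Coupled B B′ → p ≼ q → Coupled (toggle q B) B′
  toggle-upset {B} {B′} q c p≼q = record
    { antichain  = toggle-preserves-Antichain q B (antichain c)
    ; antichain′ = antichain′ c
    ; agree      = agree′
    ; avoids     = avoids c
    }
    where
    agree′ : AgreeOffUpset (toggle q B) B′
    agree′ x p⋠x with x ≟ q
    ... | yes refl = ⊥-elim (p⋠x p≼q)
    ... | no x≢q   = trans (toggle-≢ q B x x≢q) (agree c x p⋠x)

  -- L lists the elements already processed by the current pass 𝛕_i.
  Untoggled : ℕ → List (Fin n) → Subset n → Subset n → Set
  Untoggled i L S₀ B = ∀ x → (x ∈L L → rk x ≢ i) → lookup B x ≡ lookup S₀ x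

  -- A pass of 𝛕_i on both sides keeps them coupled, provided the toggles of elements
  -- off ↑p are never obstructed from above, and carries an invariant I of the P-side
  -- along the elements processed so far.
  module RankPass (i : ℕ) (I : List (Fin n) → Subset n → Set) (S₀ S₀′ : Subset n)
    (skip : ∀ q L B → ¬ (q ∈L L) → rk q ≢ i → I L B → I (q ∷ L) B)
    (step-off : ∀ q L B → ¬ (q ∈L L) → rk q ≡ i → ¬ (p ≼ q) → I L B → Antichain B →
                Untoggled i L S₀ B → NoUpsetAbove q B × I (q ∷ L) (toggle q B))
    (step-upset : ∀ q L B → ¬ (q ∈L L) → rk q ≡ i → p ≼ q → I L B → Antichain B →
                  Untoggled i L S₀ B → I (q ∷ L) (toggle q B))
    where
    pass : Coupled S₀ S₀′ → I [] S₀ → ∀ L → Unique L →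
           Coupled (τ-over ⊤ i L S₀) (τ-over (P′ p) i L S₀′) ×
           I L (τ-over ⊤ i L S₀) × Untoggled i L S₀ (τ-over ⊤ i L S₀)
    pass c I₀ [] _ = c , I₀ , λ _ _ → refl
    pass c I₀ (q ∷ L) (q∉L ∷ unique) with pass c I₀ L unique
    ... | c′ , I-L , untoggled with rk q ≟ℕ i
    ...   | no rkq≢i
      rewrite τ-step-otherRank {⊤} (τ-over ⊤ i L S₀) rkq≢i
            | τ-step-otherRank {P′ p} (τ-over (P′ p) i L S₀′) rkq≢i =
      c′ , skip q L _ (All¬⇒¬Any q∉L) rkq≢i I-L , λ x h → untoggled x (h ∘ there)
    ...   | yes rkq≡i
      rewrite τ-step-toggle {⊤} (τ-over ⊤ i L S₀) (lookup-replicate q true) rkq≡i =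
      coupled , invariant , untoggled′
      where
      B : Subset n
      B = τ-over ⊤ i L S₀
      untoggled′ : Untoggled i (q ∷ L) S₀ (toggle q B)
      untoggled′ x h with x ≟ q
      ... | yes refl = ⊥-elim (h (here refl) rkq≡i)
      ... | no x≢q   = trans (toggle-≢ q B x x≢q) (untoggled x (h ∘ there))
      coupled : Coupled (toggle q B) (τ-step (P′ p) i q (τ-over (P′ p) i L S₀′))
      coupled with p ≼? q
      ... | yes p≼q rewrite τ-step-outside {P′ p} {i} (τ-over (P′ p) i L S₀′) (P′-upset p≼q) =
        toggle-upset q c′ p≼q
      ... | no p⋠q
        rewrite τ-step-toggle {P′ p} (τ-over (P′ p) i L S₀′) (P′-off-upset p⋠q) rkq≡i =
        toggle-off-upset q c′
          (proj₁ (step-off q L B (All¬⇒¬Any q∉L) rkq≡i p⋠q I-L (antichain c′) untoggled)) p⋠q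
      invariant : I (q ∷ L) (toggle q B)
      invariant with p ≼? q
      ... | yes p≼q = step-upset q L B (All¬⇒¬Any q∉L) rkq≡i p≼q I-L (antichain c′) untoggled
      ... | no p⋠q  =
        proj₂ (step-off q L B (All¬⇒¬Any q∉L) rkq≡i p⋠q I-L (antichain c′) untoggled)

    pass-all : Coupled S₀ S₀′ → I [] S₀ →
               Coupled (τ ⊤ i S₀) (τ (P′ p) i S₀′) × I (allFinL n) (τ ⊤ i S₀) ×
               Untoggled i (allFinL n) S₀ (τ ⊤ i S₀)
    pass-all c I₀ = pass c I₀ (allFinL n) (allFin⁺ n)

module Passes {n : ℕ} (P : FinPoset n) (rk : Fin n → ℕ) (isRanked : IsRanked P rk)
              (p : Fin n) (p-minimal : FinPoset.Minimal P p) where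
  open FinPoset P
  open IsRanked isRanked
  open Rowvacuation P rk
  open AntichainTest P
  open ToggleProperties P rk
  open RankedPosetProperties P rk isRanked
  open Coupling P rk p
  private module ≼ = IsDecPartialOrder isDecPartialOrder

  rk-p : rk p ≡ 0
  rk-p = rk-min p p-minimal

  UpsetAtRank : ℕ → Subset n → Set
  UpsetAtRank k S = ∀ u → p ≼ u → lookup S u ≡ true → rk u ≡ k

  BlockedBelow : Subset n → Fin n → Set
  BlockedBelow S u = ∃[ y ] ¬ (p ≼ y) × y ≼ u × lookup S y ≡ true

  SaturatedAt : ℕ → Subset n → Set
  SaturatedAt k S = ∀ u → p ≼ u → rk u ≡ k → lookup S u ≡ true ⊎ BlockedBelow S u

  Pinned : Subset n → Set
  Pinned S = lookup S p ≡ true × (∀ u → p ≼ u → u ≢ p → lookup S u ≡ false)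

  off≢upset : ∀ {y u} → ¬ (p ≼ y) → p ≼ u → y ≢ u
  off≢upset p⋠y p≼u refl = p⋠y p≼u

  toggle-off-upset-≡ : ∀ {q u} B → ¬ (p ≼ q) → p ≼ u → lookup (toggle q B) u ≡ lookup B u
  toggle-off-upset-≡ {q} {u} B p⋠q p≼u = toggle-≢ q B u (off≢upset p⋠q p≼u ∘ sym)

  UpsetAtRank-toggle-off : ∀ {k q} B → ¬ (p ≼ q) → UpsetAtRank k B → UpsetAtRank k (toggle q B)
  UpsetAtRank-toggle-off B p⋠q atRank u p≼u u∈B′ =
    atRank u p≼u (trans (sym (toggle-off-upset-≡ B p⋠q p≼u)) u∈B′)

  UpsetAtRank⇒NoUpsetAbove : ∀ {k q} B → UpsetAtRank k B → k ≤ rk q → ¬ (p ≼ q) →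
                             NoUpsetAbove q B
  UpsetAtRank⇒NoUpsetAbove {k} {q} B atRank k≤rkq p⋠q u p≼u u∈B q≼u with q ≟ u
  ... | yes refl = p⋠q p≼u
  ... | no q≢u   = ≤⇒≯ (subst (_≤ rk q) (sym (atRank u p≼u u∈B)) k≤rkq)
                       (rk-strictMono (q≼u , q≢u))

  Pinned⇒UpsetAtRank0 : ∀ B → Pinned B → UpsetAtRank 0 B
  Pinned⇒UpsetAtRank0 B (_ , onlyP) u p≼u u∈B with u ≟ p
  ... | yes refl = rk-p
  ... | no u≢p   = ⊥-elim (false≢true (trans (sym (onlyP u p≼u u≢p)) u∈B))

  BlockedBelow-trans : ∀ {z q} B → z ≼ q → BlockedBelow B z → BlockedBelow B q
  BlockedBelow-trans B z≼q (y , p⋠y , y≼z , y∈B) = y , p⋠y , ≼.trans y≼z z≼q , y∈B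

  BlockedBelow-untoggled : ∀ {i L u} S₀ B → Untoggled i L S₀ B → rk u ≤ i → p ≼ u →
                           BlockedBelow S₀ u → BlockedBelow B u
  BlockedBelow-untoggled S₀ B untoggled rku≤i p≼u (y , p⋠y , y≼u , y∈S₀) =
    y , p⋠y , y≼u ,
    trans (untoggled y (λ _ → <⇒≢ (<-≤-trans (rk-strictMono (y≼u , off≢upset p⋠y p≼u)) rku≤i)))
          y∈S₀

  BlockedBelow⇒insert-fails : ∀ {q} B → p ≼ q → BlockedBelow B q →
                              isAntichainᵇ (B [ q ]≔ true) ≡ false
  BlockedBelow⇒insert-fails {q} B p≼q (y , p⋠y , y≼q , y∈B) =
    insert-comparable-fails B q y y∈B (off≢upset p⋠y p≼q) (inj₁ y≼q)

  -- 𝛕_j removes the part of ↑p of rank j.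
  module ClearPass (j : ℕ) (S₀ S₀′ : Subset n)
                   (atRank₀ : UpsetAtRank j S₀) (saturated₀ : SaturatedAt j S₀) where
    I : List (Fin n) → Subset n → Set
    I L B = ∀ u → p ≼ u → lookup B u ≡ true → rk u ≡ j × ¬ (u ∈L L)

    skip : ∀ q L B → ¬ (q ∈L L) → rk q ≢ j → I L B → I (q ∷ L) B
    skip q L B _ rkq≢j I-L u p≼u u∈B with I-L u p≼u u∈B
    ... | rku≡j , u∉L = rku≡j , λ { (here refl) → rkq≢j rku≡j ; (there u∈L) → u∉L u∈L }

    step-off : ∀ q L B → ¬ (q ∈L L) → rk q ≡ j → ¬ (p ≼ q) → I L B → Antichain B →
               Untoggled j L S₀ B → NoUpsetAbove q B × I (q ∷ L) (toggle q B)
    step-off q L B _ rkq≡j p⋠q I-L _ _ =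
      UpsetAtRank⇒NoUpsetAbove B (λ u p≼u u∈B → proj₁ (I-L u p≼u u∈B))
        (≤-reflexive (sym rkq≡j)) p⋠q ,
      I′
      where
      I′ : I (q ∷ L) (toggle q B)
      I′ u p≼u u∈B′ with I-L u p≼u (trans (sym (toggle-off-upset-≡ B p⋠q p≼u)) u∈B′)
      ... | rku≡j , u∉L = rku≡j , λ { (here refl) → p⋠q p≼u ; (there u∈L) → u∉L u∈L }

    step-upset : ∀ q L B → ¬ (q ∈L L) → rk q ≡ j → p ≼ q → I L B → Antichain B →
                 Untoggled j L S₀ B → I (q ∷ L) (toggle q B)
    step-upset q L B q∉L rkq≡j p≼q I-L _ untoggled = from (lookup B q) refl
      where
      from : ∀ b → lookup B q ≡ b → I (q ∷ L) (toggle q B)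
      from true q∈B rewrite toggle-remove q B q∈B = I′
        where
        I′ : I (q ∷ L) (B [ q ]≔ false)
        I′ u p≼u u∈B′ with u ≟ q
        ... | yes refl rewrite lookup∘update u B false = ⊥-elim (false≢true u∈B′)
        ... | no u≢q with I-L u p≼u (trans (sym (lookup∘update′ u≢q B false)) u∈B′)
        ...   | rku≡j , u∉L = rku≡j , λ { (here u≡q) → u≢q u≡q ; (there u∈L) → u∉L u∈L }
      from false q∉B with saturated₀ q p≼q rkq≡j
      ... | inj₁ q∈S₀ =
        ⊥-elim (false≢true (trans (sym q∉B) (trans (untoggled q (⊥-elim ∘ q∉L)) q∈S₀)))
      ... | inj₂ blocked
        rewrite toggle-blocked q B q∉B (BlockedBelow⇒insert-fails B p≼q
                  (BlockedBelow-untoggled S₀ B untoggled (≤-reflexive rkq≡j) p≼q blocked)) = I′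
        where
        I′ : I (q ∷ L) B
        I′ u p≼u u∈B with I-L u p≼u u∈B
        ... | rku≡j , u∉L = rku≡j , λ { (here refl) → false≢true (trans (sym q∉B) u∈B)
                                      ; (there u∈L) → u∉L u∈L }

    open RankPass j I S₀ S₀′ skip step-off step-upset

    result : Coupled S₀ S₀′ →
             Coupled (τ ⊤ j S₀) (τ (P′ p) j S₀′) × AvoidsUpset (τ ⊤ j S₀)
    result coupled with pass-all coupled (λ u p≼u u∈S₀ → atRank₀ u p≼u u∈S₀ , λ ())
    ... | coupled′ , I-all , _ =
      coupled′ , λ u p≼u → ¬-not (λ u∈B → proj₂ (I-all u p≼u u∈B) (∈-allFin u))

  -- 𝛕_k inserts every element of ↑p of rank k that is not blocked from below by P′.
  module FillPass (k : ℕ) (S₀ S₀′ : Subset n) (avoids₀ : AvoidsUpset S₀) where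
    SaturatedOn : List (Fin n) → Subset n → Set
    SaturatedOn L B = ∀ u → p ≼ u → rk u ≡ k → u ∈L L → lookup B u ≡ true ⊎ BlockedBelow S₀ u

    I : List (Fin n) → Subset n → Set
    I L B = UpsetAtRank k B × SaturatedOn L B

    skip : ∀ q L B → ¬ (q ∈L L) → rk q ≢ k → I L B → I (q ∷ L) B
    skip q L B _ rkq≢k (atRank , sat) = atRank , sat′
      where
      sat′ : SaturatedOn (q ∷ L) B
      sat′ u p≼u rku≡k (here refl)  = ⊥-elim (rkq≢k rku≡k)
      sat′ u p≼u rku≡k (there u∈L) = sat u p≼u rku≡k u∈L

    step-off : ∀ q L B → ¬ (q ∈L L) → rk q ≡ k → ¬ (p ≼ q) → I L B → Antichain B →
               Untoggled k L S₀ B → NoUpsetAbove q B × I (q ∷ L) (toggle q B)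
    step-off q L B _ rkq≡k p⋠q (atRank , sat) _ _ =
      UpsetAtRank⇒NoUpsetAbove B atRank (≤-reflexive (sym rkq≡k)) p⋠q ,
      UpsetAtRank-toggle-off B p⋠q atRank , sat′
      where
      sat′ : SaturatedOn (q ∷ L) (toggle q B)
      sat′ u p≼u _     (here refl)  = ⊥-elim (p⋠q p≼u)
      sat′ u p≼u rku≡k (there u∈L) with sat u p≼u rku≡k u∈L
      ... | inj₁ u∈B     = inj₁ (trans (toggle-off-upset-≡ B p⋠q p≼u) u∈B)
      ... | inj₂ blocked = inj₂ blocked

    step-upset : ∀ q L B → ¬ (q ∈L L) → rk q ≡ k → p ≼ q → I L B → Antichain B →
                 Untoggled k L S₀ B → I (q ∷ L) (toggle q B)
    step-upset q L B q∉L rkq≡k p≼q (atRank , sat) ac untoggled =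
      from (isAntichainᵇ (B [ q ]≔ true)) refl
      where
      q∉B : lookup B q ≡ false
      q∉B = trans (untoggled q (⊥-elim ∘ q∉L)) (avoids₀ q p≼q)
      from : ∀ b → isAntichainᵇ (B [ q ]≔ true) ≡ b → I (q ∷ L) (toggle q B)
      from true ok rewrite toggle-insert q B q∉B ok = atRank′ , sat′
        where
        atRank′ : UpsetAtRank k (B [ q ]≔ true)
        atRank′ u p≼u u∈B′ with u ≟ q
        ... | yes refl = rkq≡k
        ... | no u≢q   = atRank u p≼u (trans (sym (lookup∘update′ u≢q B true)) u∈B′)
        sat′ : SaturatedOn (q ∷ L) (B [ q ]≔ true)
        sat′ u p≼u rku≡k u∈qL with u ≟ q
        ... | yes refl = inj₁ (lookup∘update u B true)
        sat′ u p≼u rku≡k (here u≡q)  | no u≢q = ⊥-elim (u≢q u≡q)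
        sat′ u p≼u rku≡k (there u∈L) | no u≢q with sat u p≼u rku≡k u∈L
        ... | inj₁ u∈B     = inj₁ (trans (lookup∘update′ u≢q B true) u∈B)
        ... | inj₂ blocked = inj₂ blocked
      from false fails with insert-fails⇒comparable B q ac fails
      ... | y , y∈B , y≢q , y∼q rewrite toggle-blocked q B q∉B fails = atRank , sat′
        where
        blocked : Comparable y q → BlockedBelow S₀ q
        blocked (inj₁ y≼q) with p ≼? y
        ... | yes p≼y = ⊥-elim (y≢q (≼∧rk≡⇒≡ y≼q (trans (atRank y p≼y y∈B) (sym rkq≡k))))
        ... | no p⋠y  =
          y , p⋠y , y≼q , trans (sym (untoggled y (λ _ → ≺⇒rk≢ (y≼q , y≢q) rkq≡k))) y∈B
        blocked (inj₂ q≼y) =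
          ⊥-elim (y≢q (sym (≼∧rk≡⇒≡ q≼y
            (trans rkq≡k (sym (atRank y (≼.trans p≼q q≼y) y∈B))))))
        sat′ : SaturatedOn (q ∷ L) B
        sat′ u p≼u rku≡k (here refl)  = inj₂ (blocked y∼q)
        sat′ u p≼u rku≡k (there u∈L) = sat u p≼u rku≡k u∈L

    open RankPass k I S₀ S₀′ skip step-off step-upset

    result : Coupled S₀ S₀′ →
             Coupled (τ ⊤ k S₀) (τ (P′ p) k S₀′) ×
             UpsetAtRank k (τ ⊤ k S₀) × SaturatedAt k (τ ⊤ k S₀)
    result coupled
      with pass-all coupled
             ((λ u p≼u u∈S₀ → ⊥-elim (avoids-absurd S₀ avoids₀ p≼u u∈S₀)) , λ _ _ _ ())
    ... | coupled′ , (atRank , sat) , untoggled = coupled′ , atRank , saturated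
      where
      saturated : SaturatedAt k (τ ⊤ k S₀)
      saturated u p≼u rku≡k with sat u p≼u rku≡k (∈-allFin u)
      ... | inj₁ u∈B     = inj₁ u∈B
      ... | inj₂ blocked =
        inj₂ (BlockedBelow-untoggled S₀ (τ ⊤ k S₀) untoggled (≤-reflexive rku≡k) p≼u blocked)

  -- Once ↑p is saturated at rank k < i, 𝛕_i cannot insert any element of ↑p: every
  -- such element lies above an element of ↑p of rank k, present or blocked.
  module HigherPass (k i : ℕ) (k<i : k < i) (S₀ S₀′ : Subset n)
                    (saturated₀ : SaturatedAt k S₀) where
    I : List (Fin n) → Subset n → Set
    I _ B = UpsetAtRank k B

    skip : ∀ q L B → ¬ (q ∈L L) → rk q ≢ i → I L B → I (q ∷ L) B
    skip _ _ _ _ _ atRank = atRank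

    k≤rk : ∀ {q} → rk q ≡ i → k ≤ rk q
    k≤rk rkq≡i = subst (k ≤_) (sym rkq≡i) (<⇒≤ k<i)

    rk≡k⇒≢i : ∀ {z} → rk z ≡ k → rk z ≢ i
    rk≡k⇒≢i rkz≡k rkz≡i = <⇒≢ k<i (trans (sym rkz≡k) rkz≡i)

    step-off : ∀ q L B → ¬ (q ∈L L) → rk q ≡ i → ¬ (p ≼ q) → I L B → Antichain B →
               Untoggled i L S₀ B → NoUpsetAbove q B × I (q ∷ L) (toggle q B)
    step-off q L B _ rkq≡i p⋠q atRank _ _ =
      UpsetAtRank⇒NoUpsetAbove B atRank (k≤rk rkq≡i) p⋠q , UpsetAtRank-toggle-off B p⋠q atRank

    step-upset : ∀ q L B → ¬ (q ∈L L) → rk q ≡ i → p ≼ q → I L B → Antichain B →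
                 Untoggled i L S₀ B → I (q ∷ L) (toggle q B)
    step-upset q L B _ rkq≡i p≼q atRank _ untoggled =
      subst (UpsetAtRank k) (sym (toggle-blocked q B q∉B fails)) atRank
      where
      q∉B : lookup B q ≡ false
      q∉B = ¬-not (λ q∈B → rk≡k⇒≢i (atRank q p≼q q∈B) rkq≡i)
      fails : isAntichainᵇ (B [ q ]≔ true) ≡ false
      fails with intermediate-rank k p≼q (subst (_≤ k) (sym rk-p) z≤n) (k≤rk rkq≡i)
      ... | z , p≼z , z≼q , rkz≡k with saturated₀ z p≼z rkz≡k
      ...   | inj₁ z∈S₀ =
        insert-comparable-fails B q z (trans (untoggled z (λ _ → rk≡k⇒≢i rkz≡k)) z∈S₀)
          (λ z≡q → rk≡k⇒≢i rkz≡k (trans (cong rk z≡q) rkq≡i)) (inj₁ z≼q)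
      ...   | inj₂ blocked =
        BlockedBelow⇒insert-fails B p≼q (BlockedBelow-trans B z≼q
          (BlockedBelow-untoggled S₀ B untoggled (subst (_≤ i) (sym rkz≡k) (<⇒≤ k<i)) p≼z blocked))

    open RankPass i I S₀ S₀′ skip step-off step-upset

    result : Coupled S₀ S₀′ → UpsetAtRank k S₀ →
             Coupled (τ ⊤ i S₀) (τ (P′ p) i S₀′) ×
             UpsetAtRank k (τ ⊤ i S₀) × SaturatedAt k (τ ⊤ i S₀)
    result coupled atRank₀ with pass-all coupled atRank₀
    ... | coupled′ , atRank , untoggled = coupled′ , atRank , saturated
      where
      saturated : SaturatedAt k (τ ⊤ i S₀)
      saturated u p≼u rku≡k with saturated₀ u p≼u rku≡k
      ... | inj₁ u∈S₀    = inj₁ (trans (untoggled u (λ _ → rk≡k⇒≢i rku≡k)) u∈S₀)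
      ... | inj₂ blocked =
        inj₂ (BlockedBelow-untoggled S₀ (τ ⊤ i S₀) untoggled
               (subst (_≤ i) (sym rku≡k) (<⇒≤ k<i)) p≼u blocked)

  -- 𝛕_0 inserts p, which is then the only element of ↑p.
  module MinimalPass (S₀ S₀′ : Subset n) (avoids₀ : AvoidsUpset S₀) where
    OnlyP : Subset n → Set
    OnlyP B = ∀ u → p ≼ u → lookup B u ≡ true → u ≡ p

    I : List (Fin n) → Subset n → Set
    I L B = OnlyP B × (p ∈L L → lookup B p ≡ true)

    skip : ∀ q L B → ¬ (q ∈L L) → rk q ≢ 0 → I L B → I (q ∷ L) B
    skip q L B _ rkq≢0 (onlyP , p-in) = onlyP , p-in′
      where
      p-in′ : p ∈L (q ∷ L) → lookup B p ≡ true
      p-in′ (here refl)  = ⊥-elim (rkq≢0 rk-p)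
      p-in′ (there p∈L) = p-in p∈L

    step-off : ∀ q L B → ¬ (q ∈L L) → rk q ≡ 0 → ¬ (p ≼ q) → I L B → Antichain B →
               Untoggled 0 L S₀ B → NoUpsetAbove q B × I (q ∷ L) (toggle q B)
    step-off q L B _ _ p⋠q (onlyP , p-in) _ _ =
      UpsetAtRank⇒NoUpsetAbove B atRank0 z≤n p⋠q , onlyP′ , p-in′
      where
      atRank0 : UpsetAtRank 0 B
      atRank0 u p≼u u∈B = trans (cong rk (onlyP u p≼u u∈B)) rk-p
      onlyP′ : OnlyP (toggle q B)
      onlyP′ u p≼u u∈B′ = onlyP u p≼u (trans (sym (toggle-off-upset-≡ B p⋠q p≼u)) u∈B′)
      p-in′ : p ∈L (q ∷ L) → lookup (toggle q B) p ≡ true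
      p-in′ (here refl)  = ⊥-elim (p⋠q ≼.refl)
      p-in′ (there p∈L) = trans (toggle-off-upset-≡ B p⋠q ≼.refl) (p-in p∈L)

    step-upset : ∀ q L B → ¬ (q ∈L L) → rk q ≡ 0 → p ≼ q → I L B → Antichain B →
                 Untoggled 0 L S₀ B → I (q ∷ L) (toggle q B)
    step-upset q L B q∉L rkq≡0 p≼q (onlyP , _) ac untoggled
      with ≼∧rk≡⇒≡ p≼q (trans rk-p (sym rkq≡0))
    ... | refl = from (isAntichainᵇ (B [ p ]≔ true)) refl
      where
      p∉B : lookup B p ≡ false
      p∉B = trans (untoggled p (⊥-elim ∘ q∉L)) (avoids₀ p ≼.refl)
      from : ∀ b → isAntichainᵇ (B [ p ]≔ true) ≡ b → I (p ∷ L) (toggle p B)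
      from true ok rewrite toggle-insert p B p∉B ok = onlyP′ , λ _ → lookup∘update p B true
        where
        onlyP′ : OnlyP (B [ p ]≔ true)
        onlyP′ u p≼u u∈B′ with u ≟ p
        ... | yes u≡p = u≡p
        ... | no u≢p  = onlyP u p≼u (trans (sym (lookup∘update′ u≢p B true)) u∈B′)
      from false fails with insert-fails⇒comparable B p ac fails
      ... | y , y∈B , y≢p , inj₁ y≼p = ⊥-elim (y≢p (p-minimal y y≼p))
      ... | y , y∈B , y≢p , inj₂ p≼y = ⊥-elim (y≢p (onlyP y p≼y y∈B))

    open RankPass 0 I S₀ S₀′ skip step-off step-upset

    result : Coupled S₀ S₀′ → Coupled (τ ⊤ 0 S₀) (τ (P′ p) 0 S₀′) × Pinned (τ ⊤ 0 S₀)
    result coupled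
      with pass-all coupled
             ((λ u p≼u u∈S₀ → ⊥-elim (avoids-absurd S₀ avoids₀ p≼u u∈S₀)) , λ ())
    ... | coupled′ , (onlyP , p-in) , _ =
      coupled′ , p-in (∈-allFin p) , λ u p≼u u≢p → ¬-not (u≢p ∘ onlyP u p≼u)

  -- Toggles of positive rank never affect ↑p while p is present.
  module PinnedPass (i : ℕ) (1≤i : 1 ≤ i) (S₀ S₀′ : Subset n) where
    I : List (Fin n) → Subset n → Set
    I _ B = Pinned B

    skip : ∀ q L B → ¬ (q ∈L L) → rk q ≢ i → I L B → I (q ∷ L) B
    skip _ _ _ _ _ pinned = pinned

    rk≡i⇒≢p : ∀ {q} → rk q ≡ i → q ≢ p
    rk≡i⇒≢p rkq≡i refl = <⇒≢ 1≤i (trans (sym rk-p) rkq≡i)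

    step-off : ∀ q L B → ¬ (q ∈L L) → rk q ≡ i → ¬ (p ≼ q) → I L B → Antichain B →
               Untoggled i L S₀ B → NoUpsetAbove q B × I (q ∷ L) (toggle q B)
    step-off q L B _ _ p⋠q pinned@(p∈B , onlyP) _ _ =
      UpsetAtRank⇒NoUpsetAbove B (Pinned⇒UpsetAtRank0 B pinned) z≤n p⋠q ,
      trans (toggle-off-upset-≡ B p⋠q ≼.refl) p∈B ,
      λ u p≼u u≢p → trans (toggle-off-upset-≡ B p⋠q p≼u) (onlyP u p≼u u≢p)

    step-upset : ∀ q L B → ¬ (q ∈L L) → rk q ≡ i → p ≼ q → I L B → Antichain B →
                 Untoggled i L S₀ B → I (q ∷ L) (toggle q B)
    step-upset q L B _ rkq≡i p≼q (p∈B , onlyP) _ _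
      rewrite toggle-blocked q B (onlyP q p≼q (rk≡i⇒≢p rkq≡i))
                (insert-comparable-fails B q p p∈B (rk≡i⇒≢p rkq≡i ∘ sym) (inj₁ p≼q)) =
      p∈B , onlyP

    open RankPass i I S₀ S₀′ skip step-off step-upset

    result : Coupled S₀ S₀′ → Pinned S₀ →
             Coupled (τ ⊤ i S₀) (τ (P′ p) i S₀′) × Pinned (τ ⊤ i S₀)
    result coupled pinned with pass-all coupled pinned
    ... | coupled′ , pinned′ , _ = coupled′ , pinned′

module UpsetDeletion {n : ℕ} (P : FinPoset n) (rk : Fin n → ℕ) (isRanked : IsRanked P rk)
                     (p : Fin n) (p-minimal : FinPoset.Minimal P p) where
  open FinPoset P
  open Rowvacuation P rk
  open AntichainTest P
  open RankedPosetProperties P rk isRanked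
  open RankTruncation P rk
  open Coupling P rk p
  open Passes P rk isRanked p p-minimal
  private module ≼ = IsDecPartialOrder isDecPartialOrder

  R : ℕ
  R = rankOf ⊤

  sweep-higher : ∀ k m i → k < i → ∀ {S S′} →
                 Coupled S S′ → UpsetAtRank k S → SaturatedAt k S →
                 Coupled (sweep ⊤ i m S) (sweep (P′ p) i m S′) ×
                 UpsetAtRank k (sweep ⊤ i m S) × SaturatedAt k (sweep ⊤ i m S)
  sweep-higher k zero    i _   coupled atRank sat = coupled , atRank , sat
  sweep-higher k (suc m) i k<i {S} {S′} coupled atRank sat
    with HigherPass.result k i k<i S S′ sat coupled atRank
  ... | coupled′ , atRank′ , sat′ =
    sweep-higher k m (suc i) (≤-trans k<i (n≤1+n i)) coupled′ atRank′ sat′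

  segment-shifts : ∀ j m {S S′} → Coupled S S′ → UpsetAtRank j S → SaturatedAt j S →
                   Coupled (sweep ⊤ j (suc (suc m)) S) (sweep (P′ p) j (suc (suc m)) S′) ×
                   UpsetAtRank (suc j) (sweep ⊤ j (suc (suc m)) S) ×
                   SaturatedAt (suc j) (sweep ⊤ j (suc (suc m)) S)
  segment-shifts j m {S} {S′} coupled atRank sat
    with ClearPass.result j S S′ atRank sat coupled
  ... | coupled₁ , avoids₁ with FillPass.result (suc j) (τ ⊤ j S) (τ (P′ p) j S′) avoids₁ coupled₁
  ...   | coupled₂ , atRank₂ , sat₂ =
    sweep-higher (suc j) m (suc (suc j)) ≤-refl coupled₂ atRank₂ sat₂

  loop-clears : ∀ m j {S S′} → j + suc m ≡ suc R →
                Coupled S S′ → UpsetAtRank j S → SaturatedAt j S →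
                Coupled (loopUpTo ⊤ R j (suc m) S) (loopUpTo (P′ p) R j (suc m) S′) ×
                AvoidsUpset (loopUpTo ⊤ R j (suc m) S)
  loop-clears zero j {S} {S′} last coupled atRank sat
    rewrite trans (cong (_∸ j) (sym last)) (m+n∸m≡n j 1) = ClearPass.result j S S′ atRank sat coupled
  loop-clears (suc m) j notLast coupled atRank sat
    rewrite trans (cong (_∸ j) (sym notLast)) (m+n∸m≡n j (suc (suc m)))
    with segment-shifts j m coupled atRank sat
  ... | coupled′ , atRank′ , sat′ =
    loop-clears m (suc j) (trans (sym (+-suc j (suc m))) notLast) coupled′ atRank′ sat′

  sweep-pinned : ∀ m i → 1 ≤ i → ∀ {S S′} → Coupled S S′ → Pinned S →
                 Coupled (sweep ⊤ i m S) (sweep (P′ p) i m S′) × Pinned (sweep ⊤ i m S)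
  sweep-pinned zero    i _   coupled pinned = coupled , pinned
  sweep-pinned (suc m) i 1≤i {S} {S′} coupled pinned with PinnedPass.result i 1≤i S S′ coupled pinned
  ... | coupled′ , pinned′ = sweep-pinned m (suc i) (≤-trans 1≤i (n≤1+n i)) coupled′ pinned′

  loop-pinned : ∀ m j → 1 ≤ j → ∀ {S S′} → Coupled S S′ → Pinned S →
                Coupled (loopUpTo ⊤ R j m S) (loopUpTo (P′ p) R j m S′) × Pinned (loopUpTo ⊤ R j m S)
  loop-pinned zero    j _   coupled pinned = coupled , pinned
  loop-pinned (suc m) j 1≤j coupled pinned with sweep-pinned (suc R ∸ j) j 1≤j coupled pinned
  ... | coupled′ , pinned′ = loop-pinned m (suc j) (≤-trans 1≤j (n≤1+n j)) coupled′ pinned′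

  loop-pins : ∀ {S S′} → Coupled S S′ → AvoidsUpset S →
              Coupled (loopUpTo ⊤ R 0 (suc R) S) (loopUpTo (P′ p) R 0 (suc R) S′) ×
              Pinned (loopUpTo ⊤ R 0 (suc R) S)
  loop-pins {S} {S′} coupled avoidsS with MinimalPass.result S S′ avoidsS coupled
  ... | coupled₁ , pinned₁ with sweep-pinned R 1 ≤-refl coupled₁ pinned₁
  ...   | coupled₂ , pinned₂ = loop-pinned R 1 ≤-refl coupled₂ pinned₂

  private
    toAntichain : ∀ {A} → IsAntichain A → Antichain A
    toAntichain {A} ac x y x∈A y∈A = ac x y (lookup⇒[]= x A x∈A) (lookup⇒[]= y A y∈A)

    rankOf-P′≤R : rankOf (P′ p) ≤ R
    rankOf-P′≤R = rankOf-lub (P′ p) R (λ q _ → rk≤rankOf ⊤ q (lookup-replicate q true))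

  Rvac-off-upset : ∀ A → IsAntichain A → A ⊆ P′ p → Rvac ⊤ A ≡ ⁅ p ⁆ ∪ Rvac (P′ p) A
  Rvac-off-upset A ac A⊆P′
    rewrite Rvac≡loopUpTo ⊤ R A ≤-refl | Rvac≡loopUpTo (P′ p) R A rankOf-P′≤R =
    lookup-ext _ _ pointwise
    where
    avoidsA : AvoidsUpset A
    avoidsA x p≼x = ¬-not (λ x∈A → false≢true
      (trans (sym (P′-upset p≼x)) ([]=⇒lookup (A⊆P′ (lookup⇒[]= x A x∈A)))))
    coupled₀ : Coupled A A
    coupled₀ = record { antichain = toAntichain ac ; antichain′ = toAntichain ac
                      ; agree = λ _ _ → refl ; avoids = avoidsA }
    T T′ : Subset n
    T  = loopUpTo ⊤ R 0 (suc R) A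
    T′ = loopUpTo (P′ p) R 0 (suc R) A
    final : Coupled T T′ × Pinned T
    final = loop-pins coupled₀ avoidsA
    pointwise : ∀ x → lookup T x ≡ lookup (⁅ p ⁆ ∪ T′) x
    pointwise x rewrite lookup-zipWith _∨_ x ⁅ p ⁆ T′ with x ≟ p
    ... | yes refl rewrite []=⇒lookup (x∈⁅x⁆ x) = proj₁ (proj₂ final)
    ... | no x≢p rewrite lookup-⁅⁆-≢ x≢p with p ≼? x
    ...   | yes p≼x = trans (proj₂ (proj₂ final) x p≼x x≢p) (sym (avoids (proj₁ final) x p≼x))
    ...   | no p⋠x  = agree (proj₁ final) x p⋠x

  Rvac-containing-p : ∀ A → IsAntichain A → p ∈ A → Rvac ⊤ A ≡ Rvac (P′ p) (A - p)
  Rvac-containing-p A ac p∈A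
    rewrite Rvac≡loopUpTo ⊤ R A ≤-refl | Rvac≡loopUpTo (P′ p) R (A - p) rankOf-P′≤R =
    lookup-ext _ _ pointwise
    where
    p∈Aᵇ : lookup A p ≡ true
    p∈Aᵇ = []=⇒lookup p∈A
    upset-of-A : ∀ x → p ≼ x → lookup A x ≡ true → x ≡ p
    upset-of-A x p≼x x∈A = sym (toAntichain ac p x p∈Aᵇ x∈A p≼x)
    A-p⊆A : ∀ x → lookup (A - p) x ≡ true → lookup A x ≡ true
    A-p⊆A x x∈A-p = []=⇒lookup (p─q⊆p A ⁅ p ⁆ (lookup⇒[]= x (A - p) x∈A-p))
    coupled₀ : Coupled A (A - p)
    coupled₀ = record
      { antichain  = toAntichain ac
      ; antichain′ = Antichain-anti-mono {A} {A - p} A-p⊆A (toAntichain ac)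
      ; agree      = λ x p⋠x → sym (lookup-minus-≢ A p x λ { refl → p⋠x ≼.refl })
      ; avoids     = avoidsA-p
      }
      where
      avoidsA-p : AvoidsUpset (A - p)
      avoidsA-p x p≼x with x ≟ p
      ... | yes refl = lookup-minus-self A x
      ... | no x≢p   = ¬-not (x≢p ∘ upset-of-A x p≼x ∘ A-p⊆A x)
    atRank₀ : UpsetAtRank 0 A
    atRank₀ u p≼u u∈A = trans (cong rk (upset-of-A u p≼u u∈A)) rk-p
    saturated₀ : SaturatedAt 0 A
    saturated₀ u p≼u rku≡0 with ≼∧rk≡⇒≡ p≼u (trans rk-p (sym rku≡0))
    ... | refl = inj₁ p∈Aᵇ
    T T′ : Subset n
    T  = loopUpTo ⊤ R 0 (suc R) A
    T′ = loopUpTo (P′ p) R 0 (suc R) (A - p)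
    final : Coupled T T′ × AvoidsUpset T
    final = loop-clears R 0 refl coupled₀ atRank₀ saturated₀
    pointwise : ∀ x → lookup T x ≡ lookup T′ x
    pointwise x with p ≼? x
    ... | yes p≼x = trans (proj₂ final x p≼x) (sym (avoids (proj₁ final) x p≼x))
    ... | no p⋠x  = agree (proj₁ final) x p⋠x

proposition2p10 : (n : ℕ) (P : FinPoset n) (rk : Fin n → ℕ) → IsRanked P rk →
    (p : Fin n) → FinPoset.Minimal P p →
    (A : Subset n) → FinPoset.IsAntichain P A →
      (A ⊆ Rowvacuation.P′ P rk p →
         Rowvacuation.Rvac P rk ⊤ A ≡ ⁅ p ⁆ ∪ Rowvacuation.Rvac P rk (Rowvacuation.P′ P rk p) A)
      × (p ∈ A →
         Rowvacuation.Rvac P rk ⊤ A ≡ Rowvacuation.Rvac P rk (Rowvacuation.P′ P rk p) (A - p))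
proposition2p10 n P rk isRanked p p-minimal A ac =
  Rvac-off-upset A ac , Rvac-containing-p A ac
  where open UpsetDeletion P rk isRanked p p-minimal
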